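{- Let $q=(a_1,\dots,a_n)$, $n\ge1$, be the quiddity sequence of an infinite periodic frieze with entries $a_{i,j}$, and let $s_q=a_{1,n}-a_{2,n-1}$ be its growth coefficient. Then \[ s_q=\left(\sum_{I}(-1)^{\ell_I}\prod_{k\in I}a_k\right)+\delta_n, \] where the sum runs over all cyclic pair-excluding subsets $I\subseteq\{1,\dots,n\}$, $\ell_I=\frac{n-|I|}{2}$ is the number of pairs removed to obtain $I$, and $\delta_n=0$ if $n$ is odd, $\delta_n=1$ if $n$ is divisible by $4$, and $\delta_n=-1$ otherwise.
   Context: Friezes: given a sequence $(a_i)_{i\in\mathbb{Z}}$ of positive integers, define $a_{i,j}$ for $j\ge i-2$ by $a_{i,i-2}=0$, $a_{i,i-1}=1$, $a_{i,i}=a_i$ and the diamond rule $a_{i,j}a_{i+1,j+1}-a_{i,j+1}a_{i+1,j}=1$. This is an infinite frieze if all $a_{i,j}$ ($j\ge i$) are positive integers; it is periodic with quiddity sequence $(a_1,\dots,a_n)$ if $a_{i+n}=a_i$ for all $i$, and then the entries $a_{i,j}$ are indexed with $a_i$ taken periodically. A cyclic pair-excluding subset of $\{1,\dots,n\}$ is a subset obtained by removing zero or more disjoint pairs of consecutive elements, where $n$ and $1$ are also considered consecutive. Empty products equal $1$. -}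

module Defs where

open import Data.Bool using (Bool; true; false; if_then_else_)
open import Data.Nat as ℕ using (ℕ; zero; suc)
open import Data.Nat.DivMod using (_mod_; _/_; _%_)
open import Data.Integer as ℤ using (ℤ; +_; -_; _*_; _+_; _^_)
open import Data.Fin using (Fin; toℕ) renaming (zero to fzero; suc to fsuc)
open import Data.Fin.Properties using (all?; any?) renaming (_≟_ to _≟ᶠ_)
open import Data.Fin.Subset using (Subset; _∈_; _∉_; ∣_∣; inside; outside)
open import Data.Fin.Subset.Properties using (_∈?_; anySubset?)
open import Data.Vec using ([]; _∷_)
open import Data.Product using (Σ; ∃; _×_; _,_)
open import Data.Sum using (_⊎_)
open import Relation.Binary.PropositionalEquality using (_≡_; _≢_)
open import Relation.Nullary using (Dec; yes; no; ¬_)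
open import Relation.Nullary.Decidable using (_×-dec_; _⊎-dec_; _→-dec_; ¬?)

-- Positions 1..n are represented by Fin n (Fin element k ↔ position k+1).
-- Cyclic successor: position n is followed by position 1.
next : ∀ {n} → Fin n → Fin n
next {suc m} k = suc (toℕ k) mod (suc m)

InPair : ∀ {n} → Fin n → Fin n → Set
InPair k x = x ≡ k ⊎ x ≡ next k

-- P is the set of starting points k of the removed pairs {k, k+1}.
-- The pairs are genuine (two distinct elements), pairwise disjoint,
-- and their union is exactly the complement of I.
ValidPairing : ∀ {n} → Subset n → Subset n → Set
ValidPairing I P =
  (∀ k → k ∈ P → ¬ (k ≡ next k)) ×
  (∀ k → ∀ k' → ∀ x → k ∈ P → k' ∈ P → ¬ (k ≡ k') → ¬ (InPair k x × InPair k' x)) ×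
  (∀ x → (x ∉ I → ∃ λ k → k ∈ P × InPair k x) × ((∃ λ k → k ∈ P × InPair k x) → x ∉ I))

CyclicPairExcluding : ∀ {n} → Subset n → Set
CyclicPairExcluding I = ∃ λ P → ValidPairing I P

inPair? : ∀ {n} (k x : Fin n) → Dec (InPair k x)
inPair? k x = (x ≟ᶠ k) ⊎-dec (x ≟ᶠ next k)

validPairing? : ∀ {n} (I P : Subset n) → Dec (ValidPairing I P)
validPairing? I P =
  all? (λ k → (k ∈? P) →-dec ¬? (k ≟ᶠ next k)) ×-dec
  (all? λ k → all? λ k' → all? λ x →
     (k ∈? P) →-dec ((k' ∈? P) →-dec (¬? (k ≟ᶠ k') →-dec ¬? (inPair? k x ×-dec inPair? k' x)))) ×-dec
  all? (λ x → (¬? (x ∈? I) →-dec ex x) ×-dec (ex x →-dec ¬? (x ∈? I)))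
  where
  ex : ∀ x → Dec (∃ λ k → k ∈ P × InPair k x)
  ex x = any? (λ k → (k ∈? P) ×-dec inPair? k x)

cyclicPairExcluding? : ∀ {n} (I : Subset n) → Dec (CyclicPairExcluding I)
cyclicPairExcluding? I = anySubset? (validPairing? I)

sumSubsets : ∀ n → (Subset n → ℤ) → ℤ
sumSubsets zero g = g []
sumSubsets (suc n) g = sumSubsets n (λ I → g (outside ∷ I)) + sumSubsets n (λ I → g (inside ∷ I))

prodSubset : ∀ {n} → Subset n → (Fin n → ℤ) → ℤ
prodSubset [] g = + 1
prodSubset (b ∷ I) g = (if b then g fzero else + 1) * prodSubset I (λ k → g (fsuc k))

ℓ : ∀ {n} → Subset n → ℕ
ℓ {n} I = (n ℕ.∸ ∣ I ∣) / 2

-- Summand: (-1)^{ℓ_I} ∏_{k∈I} a_k if I is cyclic pair-excluding, 0 otherwise.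
-- Here a is indexed by ℤ; the element k of Fin n stands for position k+1.
summand : (a : ℤ → ℤ) → ∀ n → Subset n → ℤ
summand a n I with cyclicPairExcluding? I
... | yes _ = (- (+ 1)) ^ ℓ I * prodSubset I (λ k → a (+ suc (toℕ k)))
... | no _ = + 0

pairExcludingSum : (a : ℤ → ℤ) → ℕ → ℤ
pairExcludingSum a n = sumSubsets n (summand a n)

δ : ℕ → ℤ
δ n with n % 2 | n % 4
... | suc _ | _ = + 0
... | zero | zero = + 1
... | zero | suc _ = - (+ 1)

-- The diamond rule determines the frieze from its first two diagonals: since the entries are
-- positive, a_{i,j+1} can be cancelled out of the diamond at (i, j), and comparing with the
-- determinant identity of continuants shows a_{i,j} = K(a_i, …, a_j).  Hence
-- s_q = K(a_1, …, a_n) − K(a_2, …, a_{n-1}).  Expanding a continuant in its first entry writes it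
-- as the signed sum over the linear pair-excluding subsets of a path.  A cyclic pair-excluding
-- subset is either linear, or it removes the pair {n, 1} and is linear on 2, …, n−1; by
-- inclusion–exclusion the second kind contributes −K(a_2, …, a_{n-1}), and the subsets of both
-- kinds (only the empty set, for even n) contribute −δ_n.

module Submission where

open import Defs

module Continuant where

  open import Data.Nat using (ℕ; zero; suc; s≤s; z≤n)
  open import Data.Product using (_×_; _,_; proj₁)
  open import Data.Integer using (ℤ; +_; _+_; _-_; _*_; _<_; _≤_; +≤+; +<+; NonZero; >-nonZero)
  open import Data.Integer.Properties
    using (+-assoc; +-identityʳ; +-0-abelianGroup; neg-injective; *-cancelʳ-≡; ≤-trans; i-j≤i; i≤i+j; +-monoʳ-≤)
  open import Data.Integer.Tactic.RingSolver using (solve-∀)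
  open import Algebra.Properties.AbelianGroup +-0-abelianGroup using (∙-cancelˡ)
  open import Function using (_∘_)
  open import Relation.Binary.PropositionalEquality
  open ≡-Reasoning

  continuant : (ℕ → ℤ) → ℕ → ℤ
  continuant f zero = + 1
  continuant f (suc zero) = f 0
  continuant f (suc (suc n)) = f 0 * continuant (f ∘ suc) (suc n) - continuant (f ∘ suc ∘ suc) n

  continuant-cong : ∀ {f g : ℕ → ℤ} n → (∀ x → f x ≡ g x) → continuant f n ≡ continuant g n
  continuant-cong zero f≗g = refl
  continuant-cong (suc zero) f≗g = f≗g 0
  continuant-cong (suc (suc n)) f≗g =
    cong₂ _-_ (cong₂ _*_ (f≗g 0) (continuant-cong (suc n) (f≗g ∘ suc))) (continuant-cong n (f≗g ∘ suc ∘ suc))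

  continuant-det : ∀ f d →
    continuant f (suc d) * continuant (f ∘ suc) (suc d) - continuant f (suc (suc d)) * continuant (f ∘ suc) d ≡ + 1
  continuant-det f zero = base (f 0) (f 1)
    where
    base : ∀ x y → x * y - (x * y - + 1) * + 1 ≡ + 1
    base = solve-∀
  continuant-det f (suc d) = trans (shift (f 0) _ _ _ _) (continuant-det (f ∘ suc) d)
    where
    shift : ∀ x A B C D → (x * A - B) * C - (x * C - D) * A ≡ A * D - C * B
    shift = solve-∀

  -‿injectiveʳ : ∀ a {x y : ℤ} → a - x ≡ a - y → x ≡ y
  -‿injectiveʳ a eq = neg-injective (∙-cancelˡ a _ _ eq)

  module FriezeEntries (a : ℤ → ℤ) (e : ℤ → ℤ → ℤ)
      (e-sub1 : ∀ i → e i (i - + 1) ≡ + 1)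
      (e-diag : ∀ i → e i i ≡ a i)
      (diamond : ∀ i j → i - + 1 ≤ j → e i j * e (i + + 1) (j + + 1) - e i (j + + 1) * e (i + + 1) j ≡ + 1)
      (e-pos : ∀ i j → i ≤ j → + 0 < e i j) where

    row : ℤ → ℕ → ℤ
    row i k = a (i + + k)

    row-suc : ∀ i → ∀ k → row (i + + 1) k ≡ row i (suc k)
    row-suc i k = cong a (+-assoc i (+ 1) (+ k))

    EntryIsContinuant : ℕ → Set
    EntryIsContinuant d = ∀ i → e i (i + + d - + 1) ≡ continuant (row i) d

    entry-0 : EntryIsContinuant 0
    entry-0 i = trans (cong (λ j → e i (j - + 1)) (+-identityʳ i)) (e-sub1 i)

    entry-1 : EntryIsContinuant 1
    entry-1 i = trans (cong (e i) (index i)) (trans (e-diag i) (cong a (sym (+-identityʳ i))))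
      where
      index : ∀ i → i + + 1 - + 1 ≡ i
      index = solve-∀

    e-next-pos : ∀ d i → + 0 < e (i + + 1) (i + + d)
    e-next-pos zero i = subst (λ j → + 0 < e (i + + 1) j) (index i) (subst (+ 0 <_) (sym (e-sub1 (i + + 1))) (+<+ (s≤s z≤n)))
      where
      index : ∀ i → i + + 1 - + 1 ≡ i + + 0
      index = solve-∀
    e-next-pos (suc d) i = e-pos (i + + 1) (i + + suc d) (+-monoʳ-≤ i (+≤+ (s≤s z≤n)))

    entry-next : ∀ {d} → EntryIsContinuant d → ∀ i → e (i + + 1) (i + + 1 + + d - + 1) ≡ continuant (row i ∘ suc) d
    entry-next {d} entry i = trans (entry (i + + 1)) (continuant-cong d (row-suc i))

    -- With j = i + d, the diamond at (i, j) and continuant-det differ only in the unknown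
    -- a_{i,j+1}, and there it is multiplied by a_{i+1,j} > 0.
    entry-suc-suc : ∀ d → EntryIsContinuant d → EntryIsContinuant (suc d) → EntryIsContinuant (suc (suc d))
    entry-suc-suc d entry-d entry-d+1 i = begin
      e i (i + + suc (suc d) - + 1)  ≡⟨ cong (e i) (index₂ i (+ d)) ⟩
      e i (j + + 1)                  ≡⟨ *-cancelʳ-≡ _ _ c X·c≡K·c ⟩
      continuant f (suc (suc d))     ∎
      where
      j = i + + d
      f = row i
      c = e (i + + 1) j
      X = e i (j + + 1)
      K = continuant f (suc (suc d))
      AB = continuant f (suc d) * continuant (f ∘ suc) (suc d)
      instance
        c-nonZero : NonZero c
        c-nonZero = >-nonZero (e-next-pos d i)
      index₀ : ∀ i d → i + + 1 + d - + 1 ≡ i + d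
      index₀ = solve-∀
      index₁ : ∀ i d → i + (+ 1 + d) - + 1 ≡ i + d
      index₁ = solve-∀
      index₂ : ∀ i d → i + (+ 1 + (+ 1 + d)) - + 1 ≡ i + d + + 1
      index₂ = solve-∀
      index₃ : ∀ i d → i + + 1 + (+ 1 + d) - + 1 ≡ i + d + + 1
      index₃ = solve-∀
      A≡ : e i j ≡ continuant f (suc d)
      A≡ = trans (cong (e i) (sym (index₁ i (+ d)))) (entry-d+1 i)
      B≡ : e (i + + 1) (j + + 1) ≡ continuant (f ∘ suc) (suc d)
      B≡ = trans (cong (e (i + + 1)) (sym (index₃ i (+ d)))) (entry-next entry-d+1 i)
      c≡ : c ≡ continuant (f ∘ suc) d
      c≡ = trans (cong (e (i + + 1)) (sym (index₀ i (+ d)))) (entry-next entry-d i)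
      j-large : i - + 1 ≤ j
      j-large = ≤-trans (i-j≤i i (+ 1)) (i≤i+j i (+ d))
      X·c≡K·c : X * c ≡ K * c
      X·c≡K·c = -‿injectiveʳ AB (begin
        AB - X * c                           ≡⟨ cong₂ (λ u v → u * v - X * c) (sym A≡) (sym B≡) ⟩
        e i j * e (i + + 1) (j + + 1) - X * c ≡⟨ diamond i j j-large ⟩
        + 1                                  ≡⟨ sym (continuant-det f d) ⟩
        AB - K * continuant (f ∘ suc) d      ≡⟨ cong (λ z → AB - K * z) (sym c≡) ⟩
        AB - K * c                           ∎)

    entry≡continuant : ∀ d → EntryIsContinuant d
    entry≡continuant d = proj₁ (entries d)
      where
      entries : ∀ d → EntryIsContinuant d × EntryIsContinuant (suc d)
      entries zero = entry-0 , entry-1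
      entries (suc d) with entries d
      ... | entry-d , entry-d+1 = entry-d+1 , entry-suc-suc d entry-d entry-d+1

module BooleanTests where

  open import Data.Bool using (Bool; true; false; if_then_else_; _∧_; _∨_; not)
  open import Data.Nat using (ℕ; zero; suc; _<_; s≤s; z≤n)
  open import Data.Vec using (Vec; []; _∷_; _∷ʳ_)
  open import Function using (_∘_)
  open import Relation.Binary.PropositionalEquality

  infix 5 _∋ᵇ_

  -- Positions past the end of the vector count as absent.
  _∋ᵇ_ : ∀ {n} → Vec Bool n → ℕ → Bool
  [] ∋ᵇ x = false
  (b ∷ v) ∋ᵇ zero = b
  (b ∷ v) ∋ᵇ suc x = v ∋ᵇ x

  -- Are the positions x < n with f x ≡ false the union of disjoint pairs {x, x + 1}?
  linearPEᵇ : (ℕ → Bool) → ℕ → Bool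
  linearPEᵇ f zero = true
  linearPEᵇ f (suc zero) = f 0
  linearPEᵇ f (suc (suc n)) =
    if f 0 then linearPEᵇ (f ∘ suc) (suc n) else (not (f 1) ∧ linearPEᵇ (f ∘ suc ∘ suc) n)

  -- The same on the cycle 0, …, n − 1, when the removed pairs include {n − 1, 0}.
  wrappedPEᵇ : (ℕ → Bool) → ℕ → Bool
  wrappedPEᵇ f zero = false
  wrappedPEᵇ f (suc zero) = false
  wrappedPEᵇ f (suc (suc m)) = not (f 0) ∧ (not (f (suc m)) ∧ linearPEᵇ (f ∘ suc) m)

  cyclicPEᵇ : (ℕ → Bool) → ℕ → Bool
  cyclicPEᵇ f n = linearPEᵇ f n ∨ wrappedPEᵇ f n

  linearPEᵇ-cong : ∀ {f g : ℕ → Bool} n → (∀ x → x < n → f x ≡ g x) → linearPEᵇ f n ≡ linearPEᵇ g n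
  linearPEᵇ-cong zero f≗g = refl
  linearPEᵇ-cong (suc zero) f≗g = f≗g 0 (s≤s z≤n)
  linearPEᵇ-cong {f} {g} (suc (suc n)) f≗g = trans
    (cong₂ (λ r r′ → if f 0 then r else (not (f 1) ∧ r′))
      (linearPEᵇ-cong (suc n) (λ x → f≗g (suc x) ∘ s≤s))
      (linearPEᵇ-cong n (λ x → f≗g (suc (suc x)) ∘ s≤s ∘ s≤s)))
    (cong₂ (λ b c → if b then linearPEᵇ (g ∘ suc) (suc n) else (not c ∧ linearPEᵇ (g ∘ suc ∘ suc) n))
      (f≗g 0 (s≤s z≤n)) (f≗g 1 (s≤s (s≤s z≤n))))

  ∷ʳ-∋ᵇ-last : ∀ {m} (J : Vec Bool m) b → (J ∷ʳ b) ∋ᵇ m ≡ b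
  ∷ʳ-∋ᵇ-last [] b = refl
  ∷ʳ-∋ᵇ-last (c ∷ J) b = ∷ʳ-∋ᵇ-last J b

  ∷ʳ-∋ᵇ-< : ∀ {m} (J : Vec Bool m) b x → x < m → (J ∷ʳ b) ∋ᵇ x ≡ J ∋ᵇ x
  ∷ʳ-∋ᵇ-< (c ∷ J) b zero x<m = refl
  ∷ʳ-∋ᵇ-< (c ∷ J) b (suc x) (s≤s x<m) = ∷ʳ-∋ᵇ-< J b x x<m

  linearPEᵇ-∷ʳ : ∀ {m} (J : Vec Bool m) b → linearPEᵇ ((J ∷ʳ b) ∋ᵇ_) m ≡ linearPEᵇ (J ∋ᵇ_) m
  linearPEᵇ-∷ʳ {m} J b = linearPEᵇ-cong m (∷ʳ-∋ᵇ-< J b)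

  wrappedPEᵇ-padded : ∀ {m} (J : Vec Bool m) →
    wrappedPEᵇ ((false ∷ (J ∷ʳ false)) ∋ᵇ_) (suc (suc m)) ≡ linearPEᵇ (J ∋ᵇ_) m
  wrappedPEᵇ-padded {m} J = cong₂ (λ b r → not b ∧ r) (∷ʳ-∋ᵇ-last J false) (linearPEᵇ-∷ʳ J false)

  wrappedPEᵇ-last-kept : ∀ {m} (J : Vec Bool m) → wrappedPEᵇ ((false ∷ (J ∷ʳ true)) ∋ᵇ_) (suc (suc m)) ≡ false
  wrappedPEᵇ-last-kept {m} J = cong (λ b → not b ∧ linearPEᵇ ((J ∷ʳ true) ∋ᵇ_) m) (∷ʳ-∋ᵇ-last J true)

module SignedSums where

  open Continuant using (continuant)
  open BooleanTests
  open import Data.Bool using (Bool; true; false; _∧_; _∨_; if_then_else_)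
  open import Data.Nat as ℕ using (ℕ; zero; suc; s≤s; z≤n; _∸_)
  open import Data.Nat.Properties using (+-∸-assoc)
  open import Data.Nat.DivMod using (m/n≡1+[m∸n]/n)
  open import Data.Integer using (ℤ; +_; -_; _+_; _-_; _*_; _^_)
  open import Data.Integer.Properties using (*-zeroʳ; *-identityˡ; *-distribˡ-+; +-commutativeSemigroup)
  open import Data.Integer.Tactic.RingSolver using (solve-∀)
  open import Algebra.Properties.CommutativeSemigroup +-commutativeSemigroup using (interchange)
  open import Data.Fin using (toℕ)
  open import Data.Fin.Subset using (Subset; ∣_∣; inside; outside)
  open import Data.Fin.Subset.Properties using (∣p∣≤n)
  open import Data.Vec using ([]; _∷_; _∷ʳ_)
  open import Function using (_∘_)
  open import Relation.Binary.PropositionalEquality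
  open ≡-Reasoning

  when : Bool → ℤ → ℤ
  when true v = v
  when false v = + 0

  when-* : ∀ b c v → when b (c * v) ≡ c * when b v
  when-* true c v = refl
  when-* false c v = sym (*-zeroʳ c)

  when-neg : ∀ b v → when b (- v) ≡ - when b v
  when-neg true v = refl
  when-neg false v = refl

  when-∧-false : ∀ b v → when (b ∧ false) v ≡ + 0
  when-∧-false true v = refl
  when-∧-false false v = refl

  when-∨ : ∀ b c v → when (b ∨ c) v ≡ when b v + when c v - when (b ∧ c) v
  when-∨ true true v = sym (lemma v)
    where
    lemma : ∀ v → v + v - v ≡ v
    lemma = solve-∀
  when-∨ true false v = sym (lemma v)
    where
    lemma : ∀ v → v + + 0 - + 0 ≡ v
    lemma = solve-∀
  when-∨ false true v = sym (lemma v)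
    where
    lemma : ∀ v → + 0 + v - + 0 ≡ v
    lemma = solve-∀
  when-∨ false false v = refl

  neg+0+0 : ∀ x → (- x + + 0) + + 0 ≡ - x
  neg+0+0 = solve-∀

  sumSubsets-cong : ∀ n {g g′ : Subset n → ℤ} → (∀ I → g I ≡ g′ I) → sumSubsets n g ≡ sumSubsets n g′
  sumSubsets-cong zero g≗g′ = g≗g′ []
  sumSubsets-cong (suc n) g≗g′ =
    cong₂ _+_ (sumSubsets-cong n (g≗g′ ∘ (outside ∷_))) (sumSubsets-cong n (g≗g′ ∘ (inside ∷_)))

  sumSubsets-zero : ∀ n {g : Subset n → ℤ} → (∀ I → g I ≡ + 0) → sumSubsets n g ≡ + 0
  sumSubsets-zero zero g≗0 = g≗0 []
  sumSubsets-zero (suc n) g≗0 =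
    cong₂ _+_ (sumSubsets-zero n (g≗0 ∘ (outside ∷_))) (sumSubsets-zero n (g≗0 ∘ (inside ∷_)))

  sumSubsets-* : ∀ n c (g : Subset n → ℤ) → sumSubsets n (λ I → c * g I) ≡ c * sumSubsets n g
  sumSubsets-* zero c g = refl
  sumSubsets-* (suc n) c g =
    trans (cong₂ _+_ (sumSubsets-* n c (g ∘ (outside ∷_))) (sumSubsets-* n c (g ∘ (inside ∷_)))) (sym (*-distribˡ-+ c _ _))

  sumSubsets-+ : ∀ n (g g′ : Subset n → ℤ) → sumSubsets n (λ I → g I + g′ I) ≡ sumSubsets n g + sumSubsets n g′
  sumSubsets-+ zero g g′ = refl
  sumSubsets-+ (suc n) g g′ =
    trans (cong₂ _+_ (sumSubsets-+ n (g ∘ (outside ∷_)) (g′ ∘ (outside ∷_)))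
                     (sumSubsets-+ n (g ∘ (inside ∷_)) (g′ ∘ (inside ∷_))))
      (interchange (sumSubsets n (g ∘ (outside ∷_))) (sumSubsets n (g′ ∘ (outside ∷_)))
                   (sumSubsets n (g ∘ (inside ∷_))) (sumSubsets n (g′ ∘ (inside ∷_))))

  sumSubsets-neg : ∀ n (g : Subset n → ℤ) → sumSubsets n (λ I → - g I) ≡ - sumSubsets n g
  sumSubsets-neg n g = begin
    sumSubsets n (λ I → - g I)          ≡⟨ sumSubsets-cong n (neg≡-1* ∘ g) ⟩
    sumSubsets n (λ I → - + 1 * g I)    ≡⟨ sumSubsets-* n (- + 1) g ⟩
    - + 1 * sumSubsets n g              ≡⟨ neg≡-1* _ ⟨
    - sumSubsets n g                    ∎
    where
    neg≡-1* : ∀ x → - x ≡ - + 1 * x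
    neg≡-1* = solve-∀

  sumSubsets-- : ∀ n (g g′ : Subset n → ℤ) → sumSubsets n (λ I → g I - g′ I) ≡ sumSubsets n g - sumSubsets n g′
  sumSubsets-- n g g′ =
    trans (sumSubsets-+ n g (λ I → - g′ I)) (cong (λ s → sumSubsets n g + s) (sumSubsets-neg n g′))

  sumSubsets-∷ʳ : ∀ n (g : Subset (suc n) → ℤ) →
    sumSubsets (suc n) g ≡ sumSubsets n (λ J → g (J ∷ʳ outside)) + sumSubsets n (λ J → g (J ∷ʳ inside))
  sumSubsets-∷ʳ zero g = refl
  sumSubsets-∷ʳ (suc n) g =
    trans (cong₂ _+_ (sumSubsets-∷ʳ n (g ∘ (outside ∷_))) (sumSubsets-∷ʳ n (g ∘ (inside ∷_))))
      (interchange (sumSubsets n (λ J → g (outside ∷ (J ∷ʳ outside)))) (sumSubsets n (λ J → g (outside ∷ (J ∷ʳ inside))))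
                   (sumSubsets n (λ J → g (inside ∷ (J ∷ʳ outside)))) (sumSubsets n (λ J → g (inside ∷ (J ∷ʳ inside)))))

  sum-when-neg : ∀ n (b b′ : Subset n → Bool) (v v′ : Subset n → ℤ) →
    (∀ I → b I ≡ b′ I) → (∀ I → v I ≡ - v′ I) →
    sumSubsets n (λ I → when (b I) (v I)) ≡ - sumSubsets n (λ I → when (b′ I) (v′ I))
  sum-when-neg n b b′ v v′ b≗b′ v≡-v′ =
    trans (sumSubsets-cong n (λ I → trans (cong₂ when (b≗b′ I) (v≡-v′ I)) (when-neg (b′ I) (v′ I))))
      (sumSubsets-neg n (λ I → when (b′ I) (v′ I)))

  sum-when-* : ∀ n (b : Subset n → Bool) c (v v′ : Subset n → ℤ) → (∀ I → v I ≡ c * v′ I) →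
    sumSubsets n (λ I → when (b I) (v I)) ≡ c * sumSubsets n (λ I → when (b I) (v′ I))
  sum-when-* n b c v v′ v≡c*v′ =
    trans (sumSubsets-cong n (λ I → trans (cong (when (b I)) (v≡c*v′ I)) (when-* (b I) c (v′ I))))
      (sumSubsets-* n c (λ I → when (b I) (v′ I)))

  ℓ-removePair : ∀ n (I : Subset (suc (suc n))) (J : Subset n) → ∣ I ∣ ≡ ∣ J ∣ → ℓ I ≡ suc (ℓ J)
  ℓ-removePair n I J ∣I∣≡∣J∣ = begin
    (suc (suc n) ∸ ∣ I ∣) ℕ./ 2    ≡⟨ cong (λ k → (suc (suc n) ∸ k) ℕ./ 2) ∣I∣≡∣J∣ ⟩
    (suc (suc n) ∸ ∣ J ∣) ℕ./ 2    ≡⟨ cong (ℕ._/ 2) (+-∸-assoc 2 (∣p∣≤n J)) ⟩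
    suc (suc (n ∸ ∣ J ∣)) ℕ./ 2    ≡⟨ m/n≡1+[m∸n]/n {suc (suc (n ∸ ∣ J ∣))} (s≤s (s≤s z≤n)) ⟩
    suc (ℓ J)                      ∎

  signedWeight : (ℕ → ℤ) → ∀ n → Subset n → ℤ
  signedWeight h n I = (- + 1) ^ ℓ I * prodSubset I (h ∘ toℕ)

  signedSum : ∀ n → (Subset n → Bool) → (ℕ → ℤ) → ℤ
  signedSum n test h = sumSubsets n (λ I → when (test I) (signedWeight h n I))

  signedWeight-inside : ∀ h n (J : Subset n) → signedWeight h (suc n) (inside ∷ J) ≡ h 0 * signedWeight (h ∘ suc) n J
  signedWeight-inside h n J = swap ((- + 1) ^ ℓ J) (h 0) (prodSubset J (h ∘ suc ∘ toℕ))
    where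
    swap : ∀ s x p → s * (x * p) ≡ x * (s * p)
    swap = solve-∀

  signedWeight-removePair : ∀ h h′ n (I : Subset (suc (suc n))) (J : Subset n) → ∣ I ∣ ≡ ∣ J ∣ →
    prodSubset I (h ∘ toℕ) ≡ prodSubset J (h′ ∘ toℕ) → signedWeight h (suc (suc n)) I ≡ - signedWeight h′ n J
  signedWeight-removePair h h′ n I J ∣I∣≡∣J∣ ∏I≡∏J = begin
    (- + 1) ^ ℓ I * prodSubset I (h ∘ toℕ)
      ≡⟨ cong₂ (λ k p → (- + 1) ^ k * p) (ℓ-removePair n I J ∣I∣≡∣J∣) ∏I≡∏J ⟩
    (- + 1) * (- + 1) ^ ℓ J * prodSubset J (h′ ∘ toℕ)
      ≡⟨ sign ((- + 1) ^ ℓ J) (prodSubset J (h′ ∘ toℕ)) ⟩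
    - signedWeight h′ n J
      ∎
    where
    sign : ∀ s p → (- + 1) * s * p ≡ - (s * p)
    sign = solve-∀

  signedSum-linearPE : ∀ h n → signedSum n (λ I → linearPEᵇ (I ∋ᵇ_) n) h ≡ continuant h n
  signedSum-linearPE h zero = refl
  signedSum-linearPE h (suc zero) = lemma (h 0)
    where
    lemma : ∀ x → + 0 + + 1 * (x * + 1) ≡ x
    lemma = solve-∀
  signedSum-linearPE h (suc (suc n)) = begin
    (first-pair-removed + only-first-removed) + first-kept
      ≡⟨ cong₂ _+_ (cong₂ _+_ first-pair-removed≡ (sumSubsets-zero n (λ _ → refl))) first-kept≡ ⟩
    (- signedSum n linear h″ + + 0) + h 0 * signedSum (suc n) linear′ h′
      ≡⟨ cong₂ (λ x y → (- x + + 0) + h 0 * y) (signedSum-linearPE h″ n) (signedSum-linearPE h′ (suc n)) ⟩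
    (- continuant h″ n + + 0) + h 0 * continuant h′ (suc n)
      ≡⟨ recurrence (continuant h″ n) (continuant h′ (suc n)) (h 0) ⟩
    continuant h (suc (suc n))
      ∎
    where
    h′ = h ∘ suc
    h″ = h ∘ suc ∘ suc
    linear : Subset n → Bool
    linear K = linearPEᵇ (K ∋ᵇ_) n
    linear′ : Subset (suc n) → Bool
    linear′ J = linearPEᵇ (J ∋ᵇ_) (suc n)
    first-pair-removed = sumSubsets n (λ K → when (linear K) (signedWeight h (suc (suc n)) (outside ∷ outside ∷ K)))
    only-first-removed = sumSubsets n (λ K → when false (signedWeight h (suc (suc n)) (outside ∷ inside ∷ K)))
    first-kept = sumSubsets (suc n) (λ J → when (linear′ J) (signedWeight h (suc (suc n)) (inside ∷ J)))
    first-pair-removed≡ : first-pair-removed ≡ - signedSum n linear h″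
    first-pair-removed≡ = sum-when-neg n linear linear _ _ (λ _ → refl) (λ K →
      signedWeight-removePair h h″ n (outside ∷ outside ∷ K) K refl (trans (*-identityˡ _) (*-identityˡ _)))
    first-kept≡ : first-kept ≡ h 0 * signedSum (suc n) linear′ h′
    first-kept≡ = sum-when-* (suc n) linear′ (h 0) _ _ (signedWeight-inside h (suc n))
    recurrence : ∀ a b c → (- a + + 0) + c * b ≡ c * b - a
    recurrence = solve-∀

  ∣∷ʳ-outside∣ : ∀ {m} (J : Subset m) → ∣ J ∷ʳ outside ∣ ≡ ∣ J ∣
  ∣∷ʳ-outside∣ [] = refl
  ∣∷ʳ-outside∣ (true ∷ J) = cong suc (∣∷ʳ-outside∣ J)
  ∣∷ʳ-outside∣ (false ∷ J) = ∣∷ʳ-outside∣ J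

  prodSubset-∷ʳ-outside : ∀ {m} (J : Subset m) (h : ℕ → ℤ) →
    prodSubset (J ∷ʳ outside) (h ∘ toℕ) ≡ prodSubset J (h ∘ toℕ)
  prodSubset-∷ʳ-outside [] h = refl
  prodSubset-∷ʳ-outside (b ∷ J) h = cong ((if b then h 0 else + 1) *_) (prodSubset-∷ʳ-outside J (h ∘ suc))

  signedWeight-padded : ∀ h m (J : Subset m) →
    signedWeight h (suc (suc m)) (outside ∷ (J ∷ʳ outside)) ≡ - signedWeight (h ∘ suc) m J
  signedWeight-padded h m J = signedWeight-removePair h (h ∘ suc) m (outside ∷ (J ∷ʳ outside)) J (∣∷ʳ-outside∣ J)
    (trans (*-identityˡ _) (prodSubset-∷ʳ-outside J (h ∘ suc)))

  signedSum-wrappedPE : ∀ h m → signedSum (suc (suc m)) (λ I → wrappedPEᵇ (I ∋ᵇ_) (suc (suc m))) h ≡ - continuant (h ∘ suc) m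
  signedSum-wrappedPE h m = begin
    sumSubsets (suc m) (g ∘ (outside ∷_)) + sumSubsets (suc m) (g ∘ (inside ∷_))
      ≡⟨ cong₂ _+_ (sumSubsets-∷ʳ m (g ∘ (outside ∷_))) (sumSubsets-zero (suc m) (λ _ → refl)) ⟩
    (sumSubsets m (λ J → g (outside ∷ (J ∷ʳ outside))) + sumSubsets m (λ J → g (outside ∷ (J ∷ʳ inside)))) + + 0
      ≡⟨ cong (_+ + 0) (cong₂ _+_ pair-removed≡ (sumSubsets-zero m last-kept)) ⟩
    (- signedSum m linear (h ∘ suc) + + 0) + + 0
      ≡⟨ cong (λ x → (- x + + 0) + + 0) (signedSum-linearPE (h ∘ suc) m) ⟩
    (- continuant (h ∘ suc) m + + 0) + + 0
      ≡⟨ neg+0+0 (continuant (h ∘ suc) m) ⟩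
    - continuant (h ∘ suc) m
      ∎
    where
    g : Subset (suc (suc m)) → ℤ
    g I = when (wrappedPEᵇ (I ∋ᵇ_) (suc (suc m))) (signedWeight h (suc (suc m)) I)
    linear : Subset m → Bool
    linear J = linearPEᵇ (J ∋ᵇ_) m
    pair-removed≡ : sumSubsets m (λ J → g (outside ∷ (J ∷ʳ outside))) ≡ - signedSum m linear (h ∘ suc)
    pair-removed≡ = sum-when-neg m _ linear _ _ wrappedPEᵇ-padded (signedWeight-padded h m)
    last-kept : ∀ J → g (outside ∷ (J ∷ʳ inside)) ≡ + 0
    last-kept J = cong (λ b → when b (signedWeight h (suc (suc m)) (outside ∷ (J ∷ʳ inside)))) (wrappedPEᵇ-last-kept J)

  δ-suc-suc : ∀ m → δ (suc (suc m)) ≡ - δ m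
  δ-suc-suc zero = refl
  δ-suc-suc (suc zero) = refl
  δ-suc-suc (suc (suc zero)) = refl
  δ-suc-suc (suc (suc (suc zero))) = refl
  δ-suc-suc (suc (suc (suc (suc m)))) = δ-suc-suc m

  -- Only the empty set passes this test, and only when m is even.
  paddedLinearPEᵇ : ∀ {m} → Subset m → Bool
  paddedLinearPEᵇ {m} J = linearPEᵇ ((outside ∷ (J ∷ʳ outside)) ∋ᵇ_) (suc (suc m)) ∧ linearPEᵇ (J ∋ᵇ_) m

  signedSum-paddedLinearPE : ∀ h m → signedSum m paddedLinearPEᵇ h ≡ δ m
  signedSum-paddedLinearPE h zero = refl
  signedSum-paddedLinearPE h (suc zero) = refl
  signedSum-paddedLinearPE h (suc (suc m)) = begin
    (first-pair-removed + only-first-removed) + first-kept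
      ≡⟨ cong₂ _+_ (cong₂ _+_ first-pair-removed≡ (sumSubsets-zero m second-kept)) (sumSubsets-zero (suc m) (λ _ → refl)) ⟩
    (- signedSum m paddedLinearPEᵇ (h ∘ suc ∘ suc) + + 0) + + 0
      ≡⟨ cong (λ x → (- x + + 0) + + 0) (signedSum-paddedLinearPE (h ∘ suc ∘ suc) m) ⟩
    (- δ m + + 0) + + 0
      ≡⟨ neg+0+0 (δ m) ⟩
    - δ m
      ≡⟨ δ-suc-suc m ⟨
    δ (suc (suc m))
      ∎
    where
    g : Subset (suc (suc m)) → ℤ
    g J = when (paddedLinearPEᵇ J) (signedWeight h (suc (suc m)) J)
    first-pair-removed = sumSubsets m (g ∘ (outside ∷_) ∘ (outside ∷_))
    only-first-removed = sumSubsets m (g ∘ (outside ∷_) ∘ (inside ∷_))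
    first-kept = sumSubsets (suc m) (g ∘ (inside ∷_))
    first-pair-removed≡ : first-pair-removed ≡ - signedSum m paddedLinearPEᵇ (h ∘ suc ∘ suc)
    first-pair-removed≡ = sum-when-neg m _ paddedLinearPEᵇ _ _ (λ _ → refl) (λ K →
      signedWeight-removePair h (h ∘ suc ∘ suc) m (outside ∷ outside ∷ K) K refl (trans (*-identityˡ _) (*-identityˡ _)))
    second-kept : ∀ K → g (outside ∷ inside ∷ K) ≡ + 0
    second-kept K = when-∧-false (linearPEᵇ ((outside ∷ ((outside ∷ inside ∷ K) ∷ʳ outside)) ∋ᵇ_) (suc (suc (suc (suc m))))) _

  signedSum-linear∧wrappedPE : ∀ h m →
    signedSum (suc (suc m)) (λ I → linearPEᵇ (I ∋ᵇ_) (suc (suc m)) ∧ wrappedPEᵇ (I ∋ᵇ_) (suc (suc m))) h ≡ - δ m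
  signedSum-linear∧wrappedPE h m = begin
    sumSubsets (suc m) (g ∘ (outside ∷_)) + sumSubsets (suc m) (g ∘ (inside ∷_))
      ≡⟨ cong₂ _+_ (sumSubsets-∷ʳ m (g ∘ (outside ∷_))) (sumSubsets-zero (suc m) first-kept) ⟩
    (sumSubsets m (λ J → g (outside ∷ (J ∷ʳ outside))) + sumSubsets m (λ J → g (outside ∷ (J ∷ʳ inside)))) + + 0
      ≡⟨ cong (_+ + 0) (cong₂ _+_ pair-removed≡ (sumSubsets-zero m last-kept)) ⟩
    (- signedSum m paddedLinearPEᵇ (h ∘ suc) + + 0) + + 0
      ≡⟨ cong (λ x → (- x + + 0) + + 0) (signedSum-paddedLinearPE (h ∘ suc) m) ⟩
    (- δ m + + 0) + + 0
      ≡⟨ neg+0+0 (δ m) ⟩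
    - δ m
      ∎
    where
    test : Subset (suc (suc m)) → Bool
    test I = linearPEᵇ (I ∋ᵇ_) (suc (suc m)) ∧ wrappedPEᵇ (I ∋ᵇ_) (suc (suc m))
    g : Subset (suc (suc m)) → ℤ
    g I = when (test I) (signedWeight h (suc (suc m)) I)
    first-kept : ∀ J → g (inside ∷ J) ≡ + 0
    first-kept J = when-∧-false (linearPEᵇ ((inside ∷ J) ∋ᵇ_) (suc (suc m))) _
    last-kept : ∀ J → g (outside ∷ (J ∷ʳ inside)) ≡ + 0
    last-kept J = trans (cong (λ b → when (linearPEᵇ (I ∋ᵇ_) (suc (suc m)) ∧ b) (signedWeight h (suc (suc m)) I))
                               (wrappedPEᵇ-last-kept J))
                        (when-∧-false (linearPEᵇ (I ∋ᵇ_) (suc (suc m))) (signedWeight h (suc (suc m)) I))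
      where
      I = outside ∷ (J ∷ʳ inside)
    pair-removed≡ : sumSubsets m (λ J → g (outside ∷ (J ∷ʳ outside))) ≡ - signedSum m paddedLinearPEᵇ (h ∘ suc)
    pair-removed≡ = sum-when-neg m _ paddedLinearPEᵇ _ _
      (λ J → cong (linearPEᵇ ((outside ∷ (J ∷ʳ outside)) ∋ᵇ_) (suc (suc m)) ∧_) (wrappedPEᵇ-padded J))
      (signedWeight-padded h m)

  -- K_{n-1}(h 1, …, h (n-1)), with K_{-1} = 0.
  innerContinuant : (ℕ → ℤ) → ℕ → ℤ
  innerContinuant h zero = + 0
  innerContinuant h (suc m) = continuant (h ∘ suc) m

  signedSum-cyclicPE : ∀ h n →
    signedSum (suc n) (λ I → cyclicPEᵇ (I ∋ᵇ_) (suc n)) h + δ (suc n) ≡ continuant h (suc n) - innerContinuant h n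
  signedSum-cyclicPE h zero = lemma (h 0)
    where
    lemma : ∀ x → (+ 0 + + 1 * (x * + 1)) + + 0 ≡ x - + 0
    lemma = solve-∀
  signedSum-cyclicPE h (suc m) = begin
    signedSum N cyclic h + δ N
      ≡⟨ cong (_+ δ N) inclusion–exclusion ⟩
    (signedSum N linear h + signedSum N wrapped h - signedSum N (λ I → linear I ∧ wrapped I) h) + δ N
      ≡⟨ cong₂ (λ s t → s + t) (cong₂ _-_ (cong₂ _+_ (signedSum-linearPE h N) (signedSum-wrappedPE h m))
                                           (signedSum-linear∧wrappedPE h m))
                               (δ-suc-suc m) ⟩
    (continuant h N + - continuant (h ∘ suc) m - - δ m) + - δ m
      ≡⟨ cancel (continuant h N) (continuant (h ∘ suc) m) (δ m) ⟩
    continuant h N - continuant (h ∘ suc) m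
      ∎
    where
    N = suc (suc m)
    linear wrapped cyclic : Subset N → Bool
    linear I = linearPEᵇ (I ∋ᵇ_) N
    wrapped I = wrappedPEᵇ (I ∋ᵇ_) N
    cyclic I = cyclicPEᵇ (I ∋ᵇ_) N
    part : (Subset N → Bool) → Subset N → ℤ
    part test I = when (test I) (signedWeight h N I)
    inclusion–exclusion : signedSum N cyclic h
      ≡ signedSum N linear h + signedSum N wrapped h - signedSum N (λ I → linear I ∧ wrapped I) h
    inclusion–exclusion = begin
      sumSubsets N (part cyclic)
        ≡⟨ sumSubsets-cong N (λ I → when-∨ (linear I) (wrapped I) (signedWeight h N I)) ⟩
      sumSubsets N (λ I → (part linear I + part wrapped I) - part (λ I → linear I ∧ wrapped I) I)
        ≡⟨ sumSubsets-- N (λ I → part linear I + part wrapped I) (part (λ I → linear I ∧ wrapped I)) ⟩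
      sumSubsets N (λ I → part linear I + part wrapped I) - sumSubsets N (part (λ I → linear I ∧ wrapped I))
        ≡⟨ cong (_- sumSubsets N (part (λ I → linear I ∧ wrapped I))) (sumSubsets-+ N (part linear) (part wrapped)) ⟩
      sumSubsets N (part linear) + sumSubsets N (part wrapped) - sumSubsets N (part (λ I → linear I ∧ wrapped I))
        ∎
    cancel : ∀ a b d → a + - b - - d + - d ≡ a - b
    cancel = solve-∀

module Pairings where

  open BooleanTests
  open import Data.Bool using (Bool; true; false; if_then_else_; _∧_; _∨_; not)
  open import Data.Bool.Properties using (∨-zeroʳ; ∧-conicalˡ; ∧-conicalʳ; not-injective; ¬-not)
  open import Data.Nat using (ℕ; zero; suc; _+_; _<_; _≤_; s≤s; z≤n; _≟_)
  open import Data.Nat.Properties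
    using (≤-refl; ≤-reflexive; ≤-trans; n≤1+n; m≤n+m; +-suc; +-identityʳ; +-comm; <-irrefl; <⇒≢; ≤∧≢⇒<)
  open import Data.Sum using (_⊎_; inj₁; inj₂)
  open import Data.Product using (_×_; _,_; proj₁; proj₂; Σ)
  open import Data.Empty using (⊥; ⊥-elim)
  open import Function using (_∘_)
  open import Relation.Nullary using (yes; no; does)
  open import Relation.Nullary.Decidable using (dec-true; dec-false)
  open import Relation.Binary.PropositionalEquality

  -- The cycle 0, 1, …, m, followed by 0 again; start x says that {x, next x} is a removed pair.
  record Pairing (m : ℕ) (kept start : ℕ → Bool) : Set where
    field
      start-removed : ∀ x → x < suc m → start x ≡ true → kept x ≡ false
      next-removed : ∀ x → suc x < suc m → start x ≡ true → kept (suc x) ≡ false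
      wrap-removed : start m ≡ true → kept 0 ≡ false
      starts-apart : ∀ x → suc x < suc m → start x ≡ true → start (suc x) ≡ true → ⊥
      wrap-starts-apart : start m ≡ true → start 0 ≡ true → ⊥
      removed-paired : ∀ x → suc x < suc m → kept (suc x) ≡ false → start (suc x) ≡ true ⊎ start x ≡ true
      wrap-removed-paired : kept 0 ≡ false → start 0 ≡ true ⊎ start m ≡ true

  true≢false : true ≢ false
  true≢false ()

  module _ {m : ℕ} {kept start : ℕ → Bool} (P : Pairing m kept start) where
    open Pairing P

    NotSecond : ℕ → Set
    NotSecond s = kept s ≡ false → start s ≡ true

    notSecond-after-kept : ∀ s → suc s ≤ m → kept s ≡ true → NotSecond (suc s)
    notSecond-after-kept s s<m kept-s removed with removed-paired s (s≤s s<m) removed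
    ... | inj₁ start-next = start-next
    ... | inj₂ start-s = ⊥-elim (true≢false (trans (sym kept-s) (start-removed s (s≤s (≤-trans (n≤1+n s) s<m)) start-s)))

    notSecond-after-pair : ∀ s → suc (suc s) ≤ m → start s ≡ true → NotSecond (suc (suc s))
    notSecond-after-pair s s+1<m start-s removed with removed-paired (suc s) (s≤s s+1<m) removed
    ... | inj₁ start-next = start-next
    ... | inj₂ start-s+1 = ⊥-elim (starts-apart s (s≤s (≤-trans (n≤1+n _) s+1<m)) start-s start-s+1)

    -- No removed pair crosses either end of the segment s, …, l + s.
    segment-linearPE : ∀ l s → l + s ≤ m → NotSecond s → start (l + s) ≡ false →
      linearPEᵇ (λ x → kept (x + s)) (suc l) ≡ true
    segment-linearPE zero s _ not-second last-free with kept s in kept-s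
    ... | true = refl
    ... | false = ⊥-elim (true≢false (trans (sym (not-second refl)) last-free))
    segment-linearPE (suc l) s l+s<m not-second last-free with kept s in kept-s
    ... | true = trans (linearPEᵇ-cong (suc l) (λ x _ → cong kept (sym (+-suc x s))))
        (segment-linearPE l (suc s) (subst (_≤ m) (sym (+-suc l s)) l+s<m)
          (notSecond-after-kept s (≤-trans (s≤s (m≤n+m s l)) l+s<m) kept-s)
          (trans (cong start (+-suc l s)) last-free))
    ... | false rewrite next-removed s (s≤s (≤-trans (s≤s (m≤n+m s l)) l+s<m)) (not-second refl) =
      after-pair l l+s<m last-free
      where
      after-pair : ∀ l → suc l + s ≤ m → start (suc l + s) ≡ false →
        linearPEᵇ (λ x → kept (suc (suc x) + s)) l ≡ true
      after-pair zero _ _ = refl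
      after-pair (suc l) l+s<m last-free =
        trans (linearPEᵇ-cong (suc l) (λ x _ → cong kept (sym (trans (+-suc x (suc s)) (cong suc (+-suc x s))))))
          (segment-linearPE l (suc (suc s)) (subst (_≤ m) (sym (trans (+-suc l (suc s)) (cong suc (+-suc l s)))) l+s<m)
            (notSecond-after-pair s (≤-trans (s≤s (s≤s (m≤n+m s l))) l+s<m) (not-second refl))
            (trans (cong start (trans (+-suc l (suc s)) (cong suc (+-suc l s)))) last-free))

  pairing⇒linearPEᵇ : ∀ {m kept start} → Pairing m kept start → start m ≡ false → linearPEᵇ kept (suc m) ≡ true
  pairing⇒linearPEᵇ {m} {kept} {start} P last-free =
    trans (linearPEᵇ-cong (suc m) (λ x _ → cong kept (sym (+-identityʳ x))))
      (segment-linearPE P m 0 (≤-reflexive (+-identityʳ m)) first-not-second (trans (cong start (+-identityʳ m)) last-free))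
    where
    open Pairing P
    first-not-second : NotSecond P 0
    first-not-second removed with wrap-removed-paired removed
    ... | inj₁ start-0 = start-0
    ... | inj₂ start-m = ⊥-elim (true≢false (trans (sym start-m) last-free))

  pairing⇒wrappedPEᵇ : ∀ {m kept start} → Pairing m kept start → start m ≡ true → wrappedPEᵇ kept (suc m) ≡ true
  pairing⇒wrappedPEᵇ {zero} P start-0 = ⊥-elim (Pairing.wrap-starts-apart P start-0 start-0)
  pairing⇒wrappedPEᵇ {suc k} {kept} {start} P start-last
    rewrite Pairing.wrap-removed P start-last | Pairing.start-removed P (suc k) ≤-refl start-last = middle k refl
    where
    open Pairing P
    middle : ∀ j → j ≡ k → linearPEᵇ (kept ∘ suc) j ≡ true
    middle zero _ = refl
    middle (suc j) refl = trans (linearPEᵇ-cong (suc j) (λ x _ → cong kept (+-comm 1 x)))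
      (segment-linearPE P j 1 (≤-trans (≤-reflexive (+-comm j 1)) (n≤1+n _)) second-not-second
        (subst (λ y → start y ≡ false) (+-comm 1 j) (¬-not (λ start-j+1 → starts-apart (suc j) ≤-refl start-j+1 start-last))))
      where
      second-not-second : NotSecond P 1
      second-not-second removed with removed-paired 0 (s≤s (s≤s z≤n)) removed
      ... | inj₁ start-1 = start-1
      ... | inj₂ start-0 = ⊥-elim (wrap-starts-apart start-last start-0)

  pairing⇒cyclicPEᵇ : ∀ {m kept start} → Pairing m kept start → cyclicPEᵇ kept (suc m) ≡ true
  pairing⇒cyclicPEᵇ {m} {kept} {start} P with start m in start-m
  ... | false = cong (_∨ wrappedPEᵇ kept (suc m)) (pairing⇒linearPEᵇ P start-m)
  ... | true = trans (cong (linearPEᵇ kept (suc m) ∨_) (pairing⇒wrappedPEᵇ P start-m)) (∨-zeroʳ _)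

  prepend : Bool → (ℕ → Bool) → ℕ → Bool
  prepend b g zero = b
  prepend b g (suc x) = g x

  -- The pairs removed by a linear pair-excluding set, read off greedily from the left.
  linearPairing : (ℕ → Bool) → ℕ → ℕ → Bool
  linearPairing f zero = λ _ → false
  linearPairing f (suc zero) = λ _ → false
  linearPairing f (suc (suc n)) =
    if f 0 then prepend false (linearPairing (f ∘ suc) (suc n))
    else prepend true (prepend false (linearPairing (f ∘ suc ∘ suc) n))

  linearPairing-start-removed : ∀ f len x → linearPairing f len x ≡ true → f x ≡ false
  linearPairing-start-removed f zero x ()
  linearPairing-start-removed f (suc zero) x ()
  linearPairing-start-removed f (suc (suc n)) x h with f 0 in f0
  linearPairing-start-removed f (suc (suc n)) zero () | true
  linearPairing-start-removed f (suc (suc n)) (suc x) h | true = linearPairing-start-removed (f ∘ suc) (suc n) x h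
  linearPairing-start-removed f (suc (suc n)) zero h | false = f0
  linearPairing-start-removed f (suc (suc n)) (suc zero) () | false
  linearPairing-start-removed f (suc (suc n)) (suc (suc x)) h | false = linearPairing-start-removed (f ∘ suc ∘ suc) n x h

  linearPairing-next-removed : ∀ f len → linearPEᵇ f len ≡ true → ∀ x → linearPairing f len x ≡ true →
    suc x < len × f (suc x) ≡ false
  linearPairing-next-removed f zero L x ()
  linearPairing-next-removed f (suc zero) L x ()
  linearPairing-next-removed f (suc (suc n)) L x h with f 0 in f0
  linearPairing-next-removed f (suc (suc n)) L zero () | true
  linearPairing-next-removed f (suc (suc n)) L (suc x) h | true
    with linearPairing-next-removed (f ∘ suc) (suc n) L x h
  ... | x+1<len , removed = s≤s x+1<len , removed
  linearPairing-next-removed f (suc (suc n)) L zero h | false = s≤s (s≤s z≤n) , not-injective (∧-conicalˡ _ _ L)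
  linearPairing-next-removed f (suc (suc n)) L (suc zero) () | false
  linearPairing-next-removed f (suc (suc n)) L (suc (suc x)) h | false
    with linearPairing-next-removed (f ∘ suc ∘ suc) n (∧-conicalʳ _ _ L) x h
  ... | x+1<len , removed = s≤s (s≤s x+1<len) , removed

  linearPairing-apart : ∀ f len → linearPEᵇ f len ≡ true → ∀ x →
    linearPairing f len x ≡ true → linearPairing f len (suc x) ≡ true → ⊥
  linearPairing-apart f zero L x ()
  linearPairing-apart f (suc zero) L x ()
  linearPairing-apart f (suc (suc n)) L x h h′ with f 0 in f0
  linearPairing-apart f (suc (suc n)) L zero () h′ | true
  linearPairing-apart f (suc (suc n)) L (suc x) h h′ | true = linearPairing-apart (f ∘ suc) (suc n) L x h h′
  linearPairing-apart f (suc (suc n)) L zero h () | false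
  linearPairing-apart f (suc (suc n)) L (suc zero) () h′ | false
  linearPairing-apart f (suc (suc n)) L (suc (suc x)) h h′ | false =
    linearPairing-apart (f ∘ suc ∘ suc) n (∧-conicalʳ _ _ L) x h h′

  linearPairing-first : ∀ f len → linearPEᵇ f len ≡ true → 0 < len → f 0 ≡ false → linearPairing f len 0 ≡ true
  linearPairing-first f (suc zero) L _ removed = ⊥-elim (true≢false (trans (sym L) removed))
  linearPairing-first f (suc (suc n)) L _ removed with f 0 in f0
  ... | true = ⊥-elim (true≢false removed)
  ... | false = refl

  linearPairing-removed-paired : ∀ f len → linearPEᵇ f len ≡ true → ∀ x → suc x < len → f (suc x) ≡ false →
    linearPairing f len (suc x) ≡ true ⊎ linearPairing f len x ≡ true
  linearPairing-removed-paired f (suc zero) L x (s≤s ()) removed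
  linearPairing-removed-paired f (suc (suc n)) L x x+1<len removed with f 0 in f0
  linearPairing-removed-paired f (suc (suc n)) L zero x+1<len removed | true =
    inj₁ (linearPairing-first (f ∘ suc) (suc n) L (s≤s z≤n) removed)
  linearPairing-removed-paired f (suc (suc n)) L (suc x) (s≤s x+1<len) removed | true =
    linearPairing-removed-paired (f ∘ suc) (suc n) L x x+1<len removed
  linearPairing-removed-paired f (suc (suc n)) L zero x+1<len removed | false = inj₂ refl
  linearPairing-removed-paired f (suc (suc n)) L (suc zero) (s≤s (s≤s x+1<len)) removed | false =
    inj₁ (linearPairing-first (f ∘ suc ∘ suc) n (∧-conicalʳ _ _ L) x+1<len removed)
  linearPairing-removed-paired f (suc (suc n)) L (suc (suc x)) (s≤s (s≤s x+1<len)) removed | false =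
    linearPairing-removed-paired (f ∘ suc ∘ suc) n (∧-conicalʳ _ _ L) x x+1<len removed

  linearPEᵇ⇒pairing : ∀ m kept → linearPEᵇ kept (suc m) ≡ true → Pairing m kept (linearPairing kept (suc m))
  linearPEᵇ⇒pairing m kept L = record
    { start-removed = λ x _ → linearPairing-start-removed kept (suc m) x
    ; next-removed = λ x _ → proj₂ ∘ linearPairing-next-removed kept (suc m) L x
    ; wrap-removed = ⊥-elim ∘ last-not-start
    ; starts-apart = λ x _ → linearPairing-apart kept (suc m) L x
    ; wrap-starts-apart = λ start-m _ → last-not-start start-m
    ; removed-paired = linearPairing-removed-paired kept (suc m) L
    ; wrap-removed-paired = inj₁ ∘ linearPairing-first kept (suc m) L (s≤s z≤n)
    }
    where
    last-not-start : linearPairing kept (suc m) m ≡ true → ⊥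
    last-not-start = <-irrefl refl ∘ proj₁ ∘ linearPairing-next-removed kept (suc m) L m

  -- The pair {k + 1, 0} followed by the linear pairing q of the positions 1, …, k, shifted by one.
  wrapPairing : ℕ → (ℕ → Bool) → ℕ → Bool
  wrapPairing k q zero = false
  wrapPairing k q (suc x) = if does (x ≟ k) then true else q x

  wrapPairing-last : ∀ k q → wrapPairing k q (suc k) ≡ true
  wrapPairing-last k q rewrite dec-true (k ≟ k) refl = refl

  wrapPairing-middle : ∀ k q x → x ≢ k → wrapPairing k q (suc x) ≡ q x
  wrapPairing-middle k q x x≢k rewrite dec-false (x ≟ k) x≢k = refl

  wrappedPEᵇ⇒pairing : ∀ k kept → wrappedPEᵇ kept (suc (suc k)) ≡ true →
    Pairing (suc k) kept (wrapPairing k (linearPairing (kept ∘ suc) k))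
  wrappedPEᵇ⇒pairing k kept W = record
    { start-removed = start-removed
    ; next-removed = next-removed
    ; wrap-removed = λ _ → first-removed
    ; starts-apart = starts-apart
    ; wrap-starts-apart = λ _ ()
    ; removed-paired = removed-paired
    ; wrap-removed-paired = λ _ → inj₂ (wrapPairing-last k q)
    }
    where
    q = linearPairing (kept ∘ suc) k
    start = wrapPairing k q
    first-removed : kept 0 ≡ false
    first-removed = not-injective (∧-conicalˡ _ _ W)
    last-and-middle : not (kept (suc k)) ∧ linearPEᵇ (kept ∘ suc) k ≡ true
    last-and-middle = ∧-conicalʳ (not (kept 0)) _ W
    last-removed : kept (suc k) ≡ false
    last-removed = not-injective (∧-conicalˡ _ _ last-and-middle)
    middle-linear : linearPEᵇ (kept ∘ suc) k ≡ true
    middle-linear = ∧-conicalʳ (not (kept (suc k))) _ last-and-middle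
    middle-start : ∀ {y} → y < k → start (suc y) ≡ true → q y ≡ true
    middle-start y<k = trans (sym (wrapPairing-middle k q _ (<⇒≢ y<k)))
    start-removed : ∀ x → x < suc (suc k) → start x ≡ true → kept x ≡ false
    start-removed zero _ ()
    start-removed (suc y) _ h with y ≟ k
    ... | yes refl = last-removed
    ... | no y≢k = linearPairing-start-removed (kept ∘ suc) k y (trans (sym (wrapPairing-middle k q y y≢k)) h)
    next-removed : ∀ x → suc x < suc (suc k) → start x ≡ true → kept (suc x) ≡ false
    next-removed zero _ ()
    next-removed (suc y) (s≤s (s≤s y<k)) h =
      proj₂ (linearPairing-next-removed (kept ∘ suc) k middle-linear y (middle-start y<k h))
    starts-apart : ∀ x → suc x < suc (suc k) → start x ≡ true → start (suc x) ≡ true → ⊥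
    starts-apart zero _ ()
    starts-apart (suc y) (s≤s (s≤s y<k)) h h′ =
      linearPairing-apart (kept ∘ suc) k middle-linear y (middle-start y<k h) (middle-start y+1<k h′)
      where
      y+1<k = proj₁ (linearPairing-next-removed (kept ∘ suc) k middle-linear y (middle-start y<k h))
    removed-paired : ∀ x → suc x < suc (suc k) → kept (suc x) ≡ false → start (suc x) ≡ true ⊎ start x ≡ true
    removed-paired x (s≤s (s≤s x≤k)) removed with x ≟ k
    ... | yes refl = inj₁ (wrapPairing-last k q)
    removed-paired zero (s≤s (s≤s x≤k)) removed | no x≢k =
      inj₁ (trans (wrapPairing-middle k q 0 x≢k) (linearPairing-first (kept ∘ suc) k middle-linear (≤∧≢⇒< x≤k x≢k) removed))
    removed-paired (suc y) (s≤s (s≤s x≤k)) removed | no x≢k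
      with linearPairing-removed-paired (kept ∘ suc) k middle-linear y (≤∧≢⇒< x≤k x≢k) removed
    ... | inj₁ start-next = inj₁ (trans (wrapPairing-middle k q (suc y) x≢k) start-next)
    ... | inj₂ start-y = inj₂ (trans (wrapPairing-middle k q y (<⇒≢ x≤k)) start-y)

  cyclicPEᵇ⇒pairing : ∀ m kept → cyclicPEᵇ kept (suc m) ≡ true → Σ (ℕ → Bool) (Pairing m kept)
  cyclicPEᵇ⇒pairing m kept C with linearPEᵇ kept (suc m) in L
  ... | true = linearPairing kept (suc m) , linearPEᵇ⇒pairing m kept L
  cyclicPEᵇ⇒pairing zero kept () | false
  cyclicPEᵇ⇒pairing (suc k) kept W | false = wrapPairing k (linearPairing (kept ∘ suc) k) , wrappedPEᵇ⇒pairing k kept W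

module FinPairings where

  open BooleanTests
  open Pairings
  open import Data.Bool using (Bool; true; false)
  open import Data.Nat as ℕ using (ℕ; suc; _<_; s≤s; z≤n)
  open import Data.Nat.Properties using (≤-refl; ≤-trans; ≤-pred; n≤1+n; <-irrefl; ≤∧≢⇒<; 1+n≢0; suc-injective)
  open import Data.Nat.DivMod using (_%_; m<n⇒m%n≡m; n%n≡0)
  open import Data.Fin using (Fin; toℕ; fromℕ; fromℕ<; _≟_) renaming (zero to fzero; suc to fsuc)
  open import Data.Fin.Properties using (toℕ-fromℕ; toℕ-fromℕ<; fromℕ<-toℕ; toℕ-injective; toℕ<n)
  open import Data.Fin.Subset using (Subset; _∈_; _∉_)
  open import Data.Vec using (Vec; _∷_; lookup; tabulate)
  open import Data.Vec.Properties using ([]=⇒lookup; lookup⇒[]=; lookup∘tabulate)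
  open import Data.Sum using (_⊎_; inj₁; inj₂)
  open import Data.Product using (_×_; _,_; proj₁; proj₂; ∃)
  open import Data.Empty using (⊥; ⊥-elim)
  open import Function using (_∘_)
  open import Relation.Binary.PropositionalEquality
  open import Relation.Nullary using (¬_; yes; no)

  ∋ᵇ-lookup : ∀ {n} (v : Vec Bool n) (k : Fin n) → v ∋ᵇ toℕ k ≡ lookup v k
  ∋ᵇ-lookup (b ∷ v) fzero = refl
  ∋ᵇ-lookup (b ∷ v) (fsuc k) = ∋ᵇ-lookup v k

  module _ {n} {P : Subset n} {k : Fin n} {x : ℕ} (k≡x : toℕ k ≡ x) where

    ∈⇒∋ᵇ : k ∈ P → P ∋ᵇ x ≡ true
    ∈⇒∋ᵇ k∈P = trans (cong (P ∋ᵇ_) (sym k≡x)) (trans (∋ᵇ-lookup P k) ([]=⇒lookup k∈P))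

    ∋ᵇ⇒∈ : P ∋ᵇ x ≡ true → k ∈ P
    ∋ᵇ⇒∈ x∈P = lookup⇒[]= k P (trans (sym (∋ᵇ-lookup P k)) (trans (cong (P ∋ᵇ_) k≡x) x∈P))

    ∋ᵇ⇒∉ : P ∋ᵇ x ≡ false → k ∉ P
    ∋ᵇ⇒∉ x∉P k∈P = true≢false (trans (sym (∈⇒∋ᵇ k∈P)) x∉P)

    ∉⇒∋ᵇ : k ∉ P → P ∋ᵇ x ≡ false
    ∉⇒∋ᵇ k∉P with P ∋ᵇ x in x∈P
    ... | true = ⊥-elim (k∉P (∋ᵇ⇒∈ x∈P))
    ... | false = refl

  toℕ-next : ∀ {m} (k : Fin (suc m)) → (toℕ k < m × toℕ (next k) ≡ suc (toℕ k)) ⊎ (toℕ k ≡ m × toℕ (next k) ≡ 0)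
  toℕ-next {m} k with toℕ<n k
  ... | s≤s k≤m with toℕ k ℕ.≟ m
  ... | yes k≡m =
    inj₂ (k≡m , trans (toℕ-fromℕ< _) (trans (cong (λ z → suc z % suc m) k≡m) (n%n≡0 (suc m))))
  ... | no k≢m = inj₁ (k<m , trans (toℕ-fromℕ< _) (m<n⇒m%n≡m (s≤s k<m)))
    where
    k<m = ≤∧≢⇒< k≤m k≢m

  toℕ-next-suc : ∀ {m} (k : Fin (suc m)) {x} → toℕ (next k) ≡ suc x → toℕ k ≡ x
  toℕ-next-suc k next≡x+1 with toℕ-next k
  ... | inj₁ (_ , next≡) = suc-injective (trans (sym next≡) next≡x+1)
  ... | inj₂ (_ , next≡) = ⊥-elim (1+n≢0 (trans (sym next≡x+1) next≡))

  toℕ-next-zero : ∀ {m} (k : Fin (suc m)) → toℕ (next k) ≡ 0 → toℕ k ≡ m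
  toℕ-next-zero k next≡0 with toℕ-next k
  ... | inj₁ (_ , next≡) = ⊥-elim (1+n≢0 (trans (sym next≡) next≡0))
  ... | inj₂ (k≡m , _) = k≡m

  next-fromℕ< : ∀ {m x} (x<1+m : x < suc m) (x+1<1+m : suc x < suc m) → next (fromℕ< x<1+m) ≡ fromℕ< x+1<1+m
  next-fromℕ< x<1+m x+1<1+m with toℕ-next (fromℕ< x<1+m)
  ... | inj₁ (_ , next≡) = toℕ-injective (trans next≡ (trans (cong suc (toℕ-fromℕ< x<1+m)) (sym (toℕ-fromℕ< x+1<1+m))))
  ... | inj₂ (x≡m , _) = ⊥-elim (<-irrefl (trans (sym (toℕ-fromℕ< x<1+m)) x≡m) (≤-pred x+1<1+m))

  next-fromℕ : ∀ m → next (fromℕ m) ≡ fzero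
  next-fromℕ m with toℕ-next (fromℕ m)
  ... | inj₁ (m<m , _) = ⊥-elim (<-irrefl (toℕ-fromℕ m) m<m)
  ... | inj₂ (_ , next≡0) = toℕ-injective next≡0

  next-injective : ∀ {m} (a b : Fin (suc m)) → next a ≡ next b → a ≡ b
  next-injective a b next≡ with toℕ-next a
  ... | inj₁ (_ , next-a≡) = toℕ-injective (sym (toℕ-next-suc b (trans (cong toℕ (sym next≡)) next-a≡)))
  ... | inj₂ (a≡m , next-a≡) = toℕ-injective (trans a≡m (sym (toℕ-next-zero b (trans (cong toℕ (sym next≡)) next-a≡))))

  validPairing⇒pairing : ∀ {m} (I P : Subset (suc m)) → ValidPairing I P → Pairing m (I ∋ᵇ_) (P ∋ᵇ_)
  validPairing⇒pairing {m} I P (genuine , disjoint , complement) = record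
    { start-removed = start-removed
    ; next-removed = next-removed
    ; wrap-removed = wrap-removed
    ; starts-apart = starts-apart
    ; wrap-starts-apart = wrap-starts-apart
    ; removed-paired = removed-paired
    ; wrap-removed-paired = wrap-removed-paired
    }
    where
    removed : ∀ {k y} → k ∈ P → InPair k y → y ∉ I
    removed k∈P y∈pair = proj₂ (complement _) (_ , k∈P , y∈pair)
    adjacent-starts : ∀ {a b} → a ∈ P → b ∈ P → b ≡ next a → ⊥
    adjacent-starts {a} {b} a∈P b∈P b≡next-a with a ≟ b
    ... | yes refl = genuine a a∈P b≡next-a
    ... | no a≢b = disjoint a b b a∈P b∈P a≢b (inj₂ b≡next-a , inj₁ refl)
    start-removed : ∀ x → x < suc m → P ∋ᵇ x ≡ true → I ∋ᵇ x ≡ false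
    start-removed x x<1+m start-x =
      ∉⇒∋ᵇ (toℕ-fromℕ< x<1+m) (removed (∋ᵇ⇒∈ (toℕ-fromℕ< x<1+m) start-x) (inj₁ refl))
    next-removed : ∀ x → suc x < suc m → P ∋ᵇ x ≡ true → I ∋ᵇ suc x ≡ false
    next-removed x x+1<1+m start-x = ∉⇒∋ᵇ (toℕ-fromℕ< x+1<1+m)
      (removed (∋ᵇ⇒∈ (toℕ-fromℕ< x<1+m) start-x) (inj₂ (sym (next-fromℕ< x<1+m x+1<1+m))))
      where
      x<1+m = ≤-trans (n≤1+n _) x+1<1+m
    wrap-removed : P ∋ᵇ m ≡ true → I ∋ᵇ 0 ≡ false
    wrap-removed start-m =
      ∉⇒∋ᵇ {k = fzero} refl (removed (∋ᵇ⇒∈ (toℕ-fromℕ m) start-m) (inj₂ (sym (next-fromℕ m))))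
    starts-apart : ∀ x → suc x < suc m → P ∋ᵇ x ≡ true → P ∋ᵇ suc x ≡ true → ⊥
    starts-apart x x+1<1+m start-x start-x+1 =
      adjacent-starts (∋ᵇ⇒∈ (toℕ-fromℕ< x<1+m) start-x) (∋ᵇ⇒∈ (toℕ-fromℕ< x+1<1+m) start-x+1)
        (sym (next-fromℕ< x<1+m x+1<1+m))
      where
      x<1+m = ≤-trans (n≤1+n _) x+1<1+m
    wrap-starts-apart : P ∋ᵇ m ≡ true → P ∋ᵇ 0 ≡ true → ⊥
    wrap-starts-apart start-m start-0 =
      adjacent-starts (∋ᵇ⇒∈ (toℕ-fromℕ m) start-m) (∋ᵇ⇒∈ {k = fzero} refl start-0) (sym (next-fromℕ m))
    removed-paired : ∀ x → suc x < suc m → I ∋ᵇ suc x ≡ false → P ∋ᵇ suc x ≡ true ⊎ P ∋ᵇ x ≡ true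
    removed-paired x x+1<1+m x+1∉I with proj₁ (complement _) (∋ᵇ⇒∉ (toℕ-fromℕ< x+1<1+m) x+1∉I)
    ... | k , k∈P , inj₁ y≡k = inj₁ (∈⇒∋ᵇ (trans (cong toℕ (sym y≡k)) (toℕ-fromℕ< x+1<1+m)) k∈P)
    ... | k , k∈P , inj₂ y≡next-k =
      inj₂ (∈⇒∋ᵇ (toℕ-next-suc k (trans (cong toℕ (sym y≡next-k)) (toℕ-fromℕ< x+1<1+m))) k∈P)
    wrap-removed-paired : I ∋ᵇ 0 ≡ false → P ∋ᵇ 0 ≡ true ⊎ P ∋ᵇ m ≡ true
    wrap-removed-paired 0∉I with proj₁ (complement fzero) (∋ᵇ⇒∉ {k = fzero} refl 0∉I)
    ... | k , k∈P , inj₁ 0≡k = inj₁ (∈⇒∋ᵇ (cong toℕ (sym 0≡k)) k∈P)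
    ... | k , k∈P , inj₂ 0≡next-k = inj₂ (∈⇒∋ᵇ (toℕ-next-zero k (cong toℕ (sym 0≡next-k))) k∈P)

  pairing⇒validPairing : ∀ {m} (I P : Subset (suc m)) → Pairing m (I ∋ᵇ_) (P ∋ᵇ_) → ValidPairing I P
  pairing⇒validPairing {m} I P pairing = genuine , disjoint , λ y → covered y , uncovered
    where
    open Pairing pairing
    adjacent-starts : ∀ a b → a ∈ P → b ≡ next a → b ∈ P → ⊥
    adjacent-starts a b a∈P refl b∈P with toℕ-next a
    ... | inj₁ (a<m , next≡) = starts-apart (toℕ a) (s≤s a<m) (∈⇒∋ᵇ refl a∈P) (∈⇒∋ᵇ next≡ b∈P)
    ... | inj₂ (a≡m , next≡) = wrap-starts-apart (∈⇒∋ᵇ a≡m a∈P) (∈⇒∋ᵇ next≡ b∈P)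
    genuine : ∀ k → k ∈ P → ¬ (k ≡ next k)
    genuine k k∈P k≡next-k = adjacent-starts k k k∈P k≡next-k k∈P
    disjoint : ∀ k k′ y → k ∈ P → k′ ∈ P → ¬ (k ≡ k′) → ¬ (InPair k y × InPair k′ y)
    disjoint k k′ y k∈P k′∈P k≢k′ (inj₁ y≡k , inj₁ y≡k′) = k≢k′ (trans (sym y≡k) y≡k′)
    disjoint k k′ y k∈P k′∈P k≢k′ (inj₁ y≡k , inj₂ y≡next-k′) =
      adjacent-starts k′ k k′∈P (trans (sym y≡k) y≡next-k′) k∈P
    disjoint k k′ y k∈P k′∈P k≢k′ (inj₂ y≡next-k , inj₁ y≡k′) =
      adjacent-starts k k′ k∈P (trans (sym y≡k′) y≡next-k) k′∈P
    disjoint k k′ y k∈P k′∈P k≢k′ (inj₂ y≡next-k , inj₂ y≡next-k′) =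
      k≢k′ (next-injective k k′ (trans (sym y≡next-k) y≡next-k′))
    covered : ∀ y → y ∉ I → ∃ λ k → k ∈ P × InPair k y
    covered fzero 0∉I with wrap-removed-paired (∉⇒∋ᵇ refl 0∉I)
    ... | inj₁ start-0 = fzero , ∋ᵇ⇒∈ refl start-0 , inj₁ refl
    ... | inj₂ start-m = fromℕ m , ∋ᵇ⇒∈ (toℕ-fromℕ m) start-m , inj₂ (sym (next-fromℕ m))
    covered (fsuc y) y+1∉I with removed-paired (toℕ y) (toℕ<n (fsuc y)) (∉⇒∋ᵇ refl y+1∉I)
    ... | inj₁ start-y+1 = fsuc y , ∋ᵇ⇒∈ refl start-y+1 , inj₁ refl
    ... | inj₂ start-y = fromℕ< y<1+m , ∋ᵇ⇒∈ (toℕ-fromℕ< y<1+m) start-y , inj₂ y+1≡next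
      where
      y<1+m = ≤-trans (n≤1+n _) (toℕ<n (fsuc y))
      y+1≡next : fsuc y ≡ next (fromℕ< y<1+m)
      y+1≡next = sym (trans (next-fromℕ< y<1+m (toℕ<n (fsuc y))) (fromℕ<-toℕ (fsuc y) (toℕ<n (fsuc y))))
    uncovered : ∀ {y} → (∃ λ k → k ∈ P × InPair k y) → y ∉ I
    uncovered (k , k∈P , inj₁ refl) = ∋ᵇ⇒∉ refl (start-removed (toℕ k) (toℕ<n k) (∈⇒∋ᵇ refl k∈P))
    uncovered (k , k∈P , inj₂ refl) with toℕ-next k
    ... | inj₁ (k<m , next≡) = ∋ᵇ⇒∉ next≡ (next-removed (toℕ k) (s≤s k<m) (∈⇒∋ᵇ refl k∈P))
    ... | inj₂ (k≡m , next≡) = ∋ᵇ⇒∉ next≡ (wrap-removed (∈⇒∋ᵇ k≡m k∈P))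

  Pairing-cong : ∀ {m kept start start′} → (∀ x → x < suc m → start x ≡ start′ x) →
    Pairing m kept start → Pairing m kept start′
  Pairing-cong {m} {kept} {start} {start′} start≗start′ pairing = record
    { start-removed = λ x x<1+m → start-removed x x<1+m ∘ from x<1+m
    ; next-removed = λ x x+1<1+m → next-removed x x+1<1+m ∘ from (≤-trans (n≤1+n _) x+1<1+m)
    ; wrap-removed = wrap-removed ∘ from ≤-refl
    ; starts-apart = λ x x+1<1+m s s′ → starts-apart x x+1<1+m (from (≤-trans (n≤1+n _) x+1<1+m) s) (from x+1<1+m s′)
    ; wrap-starts-apart = λ s s′ → wrap-starts-apart (from ≤-refl s) (from (s≤s z≤n) s′)
    ; removed-paired = λ x x+1<1+m →
        Data.Sum.map (to x+1<1+m) (to (≤-trans (n≤1+n _) x+1<1+m)) ∘ removed-paired x x+1<1+m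
    ; wrap-removed-paired = Data.Sum.map (to (s≤s z≤n)) (to ≤-refl) ∘ wrap-removed-paired
    }
    where
    open Pairing pairing
    from : ∀ {x} → x < suc m → start′ x ≡ true → start x ≡ true
    from {x} x<1+m = trans (start≗start′ x x<1+m)
    to : ∀ {x} → x < suc m → start x ≡ true → start′ x ≡ true
    to {x} x<1+m = trans (sym (start≗start′ x x<1+m))

  ∋ᵇ-tabulate : ∀ {m} (f : ℕ → Bool) x → x < suc m → f x ≡ tabulate {n = suc m} (f ∘ toℕ) ∋ᵇ x
  ∋ᵇ-tabulate {m} f x x<1+m = sym (begin
    v ∋ᵇ x              ≡⟨ cong (v ∋ᵇ_) (toℕ-fromℕ< x<1+m) ⟨
    v ∋ᵇ toℕ k          ≡⟨ ∋ᵇ-lookup v k ⟩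
    lookup v k          ≡⟨ lookup∘tabulate (f ∘ toℕ) k ⟩
    f (toℕ k)           ≡⟨ cong f (toℕ-fromℕ< x<1+m) ⟩
    f x                 ∎)
    where
    open ≡-Reasoning
    v : Subset (suc m)
    v = tabulate (f ∘ toℕ)
    k : Fin (suc m)
    k = fromℕ< x<1+m

  cyclicPairExcluding⇒cyclicPEᵇ : ∀ {m} (I : Subset (suc m)) → CyclicPairExcluding I → cyclicPEᵇ (I ∋ᵇ_) (suc m) ≡ true
  cyclicPairExcluding⇒cyclicPEᵇ I (P , valid) = pairing⇒cyclicPEᵇ (validPairing⇒pairing I P valid)

  cyclicPEᵇ⇒cyclicPairExcluding : ∀ {m} (I : Subset (suc m)) → cyclicPEᵇ (I ∋ᵇ_) (suc m) ≡ true → CyclicPairExcluding I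
  cyclicPEᵇ⇒cyclicPairExcluding {m} I cyclic with cyclicPEᵇ⇒pairing m (I ∋ᵇ_) cyclic
  ... | start , pairing = P , pairing⇒validPairing I P (Pairing-cong (∋ᵇ-tabulate start) pairing)
    where
    P = tabulate (start ∘ toℕ)

open Continuant
open SignedSums
open BooleanTests using (_∋ᵇ_; cyclicPEᵇ)
open FinPairings using (cyclicPairExcluding⇒cyclicPEᵇ; cyclicPEᵇ⇒cyclicPairExcluding)
open import Data.Nat using (ℕ; zero; suc; _≥_)
open import Data.Integer using (ℤ; +_; _+_; _-_; _*_; _<_; _≤_)
open import Data.Integer.Tactic.RingSolver using (solve-∀)
open import Data.Bool using (Bool; true; false)
open import Data.Fin.Subset using (Subset)
open import Data.Empty using (⊥-elim)
open import Relation.Binary.PropositionalEquality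
open import Relation.Nullary using (yes; no)
open ≡-Reasoning

summand≡when-cyclicPEᵇ : ∀ a m (I : Subset (suc m)) →
  summand a (suc m) I ≡ when (cyclicPEᵇ (I ∋ᵇ_) (suc m)) (signedWeight (λ x → a (+ suc x)) (suc m) I)
summand≡when-cyclicPEᵇ a m I with cyclicPairExcluding? I
... | yes cyclic rewrite cyclicPairExcluding⇒cyclicPEᵇ I cyclic = refl
... | no ¬cyclic with cyclicPEᵇ (I ∋ᵇ_) (suc m) in cyclic
...   | true = ⊥-elim (¬cyclic (cyclicPEᵇ⇒cyclicPairExcluding I cyclic))
...   | false = refl

theoremB : (n : ℕ) → n ≥ 1 →
    (a : ℤ → ℤ) → (e : ℤ → ℤ → ℤ) →
    (∀ i → + 0 < a i) →
    (∀ i → a (i + + n) ≡ a i) →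
    (∀ i → e i (i - + 2) ≡ + 0) →
    (∀ i → e i (i - + 1) ≡ + 1) →
    (∀ i → e i i ≡ a i) →
    (∀ i j → i - + 1 ≤ j → e i j * e (i + + 1) (j + + 1) - e i (j + + 1) * e (i + + 1) j ≡ + 1) →
    (∀ i j → i ≤ j → + 0 < e i j) →
    e (+ 1) (+ n) - e (+ 2) (+ n - + 1) ≡ pairExcludingSum a n + δ n
theoremB (suc m) _ a e _ _ e-sub2 e-sub1 e-diag diamond e-pos = begin
  e (+ 1) (+ suc m) - e (+ 2) (+ suc m - + 1)   ≡⟨ cong₂ _-_ first-row (second-row m) ⟩
  continuant h (suc m) - innerContinuant h m     ≡⟨ signedSum-cyclicPE h m ⟨
  signedSum (suc m) cyclic h + δ (suc m)         ≡⟨ cong (_+ δ (suc m)) (sumSubsets-cong (suc m) (summand≡when-cyclicPEᵇ a m)) ⟨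
  pairExcludingSum a (suc m) + δ (suc m)         ∎
  where
  open FriezeEntries a e e-sub1 e-diag diamond e-pos
  h : ℕ → ℤ
  h x = a (+ suc x)
  cyclic : Subset (suc m) → Bool
  cyclic I = cyclicPEᵇ (I ∋ᵇ_) (suc m)
  first-row : e (+ 1) (+ suc m) ≡ continuant h (suc m)
  first-row = trans (cong (e (+ 1)) (index (+ m))) (entry≡continuant (suc m) (+ 1))
    where
    index : ∀ k → + 1 + k ≡ + 1 + (+ 1 + k) - + 1
    index = solve-∀
  second-row : ∀ l → e (+ 2) (+ suc l - + 1) ≡ innerContinuant h l
  second-row zero = e-sub2 (+ 2)
  second-row (suc l) = trans (cong (e (+ 2)) (index (+ l))) (entry≡continuant l (+ 2))
    where
    index : ∀ k → + 1 + (+ 1 + k) - + 1 ≡ + 2 + k - + 1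
    index = solve-∀
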